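{- Let $(W,S)$ be a simply-laced triangle-free Coxeter system and let ${\boldsymbol{\varphi}}$ be a Fibonacci link of rank $r\ge2$. Then ${\boldsymbol{\varphi}}$ is the unique Fibonacci link in the braid class $[{\boldsymbol{\varphi}}]$.
   Context: A Coxeter system $(W,S)$: finite $S$, $W=\langle S\mid (st)^{m(s,t)}=e\rangle$, $m(s,s)=1$, $m(s,t)\in\{2,3,\dots,\infty\}$ for $s\ne t$; simply laced: $m(s,t)\le3$; Coxeter graph $\Gamma$ on $S$ with edge $\{s,t\}$ iff $m(s,t)\ge3$; triangle free: no three-cycles in $\Gamma$. Reduced expression: minimal-length word for its element. Braid move: replace consecutive $sts$ by $tst$ with $m(s,t)=3$; braid class $[{\boldsymbol{\alpha}}]$: reduced expressions reachable from ${\boldsymbol{\alpha}}$ by braid moves. For ${\boldsymbol{\alpha}}=s_{x_1}\cdots s_{x_m}$, $\llbracket i,i+2\rrbracket$ is a braid shadow if $s_{x_i}=s_{x_{i+2}}$ and $m(s_{x_i},s_{x_{i+1}})=3$; $\operatorname{bs}({\boldsymbol{\alpha}})$ is the set of braid shadows, $\operatorname{bs}([{\boldsymbol{\alpha}}])$ the union over the braid class, $\operatorname{rank}({\boldsymbol{\alpha}})=|\operatorname{bs}([{\boldsymbol{\alpha}}])|$. A reduced expression with $m\ge1$ letters is a link if $m=1$ or $m$ is odd and $\operatorname{bs}([{\boldsymbol{\alpha}}])=\{\llbracket1,3\rrbracket,\dots,\llbracket m-2,m\rrbracket\}$. A Fibonacci link is a link ${\boldsymbol{\varphi}}$ with $\operatorname{bs}([{\boldsymbol{\varphi}}])=\operatorname{bs}({\boldsymbol{\varphi}})$.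 -}

module Defs where

open import Data.Nat using (ℕ; zero; suc; _+_; _*_; _∸_; _≤_; _<_)
open import Data.Fin using (Fin)
open import Data.List using (List; []; _∷_; _++_; length)
open import Data.List.Membership.Propositional using (_∈_)
open import Data.List.Relation.Unary.Unique.Propositional using (Unique)
open import Data.Maybe using (Maybe; just; nothing)
open import Data.Product using (Σ; ∃; _×_; _,_)
open import Data.Sum using (_⊎_)
open import Data.Empty using (⊥)
open import Relation.Nullary using (¬_)
open import Relation.Binary.PropositionalEquality using (_≡_)
open import Relation.Binary.Construct.Closure.ReflexiveTransitive using (Star)
open import Function.Bundles using (_⇔_)

-- A Coxeter matrix on the finite generating set S = Fin n (finite entries only;
-- entries ∞ are excluded anyway by the simply-laced hypothesis).
record CoxeterMatrix (n : ℕ) : Set where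
  field
    m      : Fin n → Fin n → ℕ
    diag   : ∀ s → m s s ≡ 1
    sym    : ∀ s t → m s t ≡ m t s
    offdia : ∀ s t → ¬ (s ≡ t) → 2 ≤ m s t
open CoxeterMatrix public

module _ {n : ℕ} (M : CoxeterMatrix n) where

  Word : Set
  Word = List (Fin n)

  alt : Fin n → Fin n → ℕ → Word
  alt s t zero    = []
  alt s t (suc k) = s ∷ t ∷ alt s t k

  relator : Fin n → Fin n → Word
  relator s t = alt s t (m M s t)

  -- Equality in W = ⟨ S | (st)^{m(s,t)} = e ⟩ of the elements represented by words
  -- (as s² = e, every element is represented by a positive word).
  data _≈W_ : Word → Word → Set where
    ≈-refl  : ∀ {u} → u ≈W u
    ≈-sym   : ∀ {u v} → u ≈W v → v ≈W u
    ≈-trans : ∀ {u v w} → u ≈W v → v ≈W w → u ≈W w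
    ≈-rel   : ∀ u v s t → (u ++ relator s t ++ v) ≈W (u ++ v)

  Reduced : Word → Set
  Reduced α = ∀ β → β ≈W α → length α ≤ length β

  SimplyLaced : Set
  SimplyLaced = ∀ s t → m M s t ≤ 3

  Edge : Fin n → Fin n → Set
  Edge s t = ¬ (s ≡ t) × 3 ≤ m M s t

  TriangleFree : Set
  TriangleFree = ∀ s t u → ¬ (Edge s t × Edge t u × Edge s u)

  data BraidMove : Word → Word → Set where
    braid : ∀ u v s t → m M s t ≡ 3 →
            BraidMove (u ++ s ∷ t ∷ s ∷ v) (u ++ t ∷ s ∷ t ∷ v)

  InBraidClass : Word → Word → Set
  InBraidClass α β = Star BraidMove α β

  -- entry at 0-based position
  at : Word → ℕ → Maybe (Fin n)
  at []      _       = nothing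
  at (x ∷ _) zero    = just x
  at (_ ∷ xs) (suc k) = at xs k

  -- ⟦i, i+2⟧ (1-based i) is a braid shadow of α
  Shadow : Word → ℕ → Set
  Shadow α i = 1 ≤ i × Σ (Fin n) λ a → Σ (Fin n) λ b →
               at α (i ∸ 1) ≡ just a × at α i ≡ just b × at α (i + 1) ≡ just a
               × m M a b ≡ 3

  ClassShadow : Word → ℕ → Set
  ClassShadow α i = ∃ λ β → InBraidClass α β × Shadow β i

  Rank : Word → ℕ → Set
  Rank α r = ∃ λ (L : List ℕ) → Unique L × (∀ i → (i ∈ L) ⇔ ClassShadow α i) × length L ≡ r

  Link : Word → Set
  Link α = Reduced α × 1 ≤ length α ×
    ( length α ≡ 1
    ⊎ ( (∃ λ k → length α ≡ 2 * k + 1)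
      × (∀ i → ClassShadow α i ⇔ ((∃ λ k → i ≡ 2 * k + 1) × i + 2 ≤ length α)) ) )

  FibonacciLink : Word → Set
  FibonacciLink φ = Link φ × (∀ i → ClassShadow φ i ⇔ Shadow φ i)

-- A Fibonacci link has braid shadows at exactly its odd positions, so it is a zigzag
-- a b₁ a b₂ ⋯ bₖ a with every bᵢ joined to a and consecutive bᵢ distinct. When the
-- Coxeter graph has no triangles, a braid move can only turn a factor a bᵢ a into
-- bᵢ a bᵢ or back, so the braid class lies among the zigzags with some pairwise disjoint
-- factors flipped. If a word of the class has shadows at all odd positions, then a
-- flipped first factor b₁ a b₁ b₂ ⋯ forces the shadow b₁ b₂ b₁ and hence the triangle
-- a, b₁, b₂ as soon as k ≥ 2, while a word starting with a has no flipped factor at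
-- all. Rank at least 2 gives k ≥ 2, so the zigzag is the only Fibonacci link in its class.
module Submission where

open import Defs hiding (sym)
open import Data.Nat using (ℕ; zero; suc; _+_; _*_; _≤_; _<_; z≤n; s≤s)
open import Data.Nat.Properties using (+-comm; +-suc; ≤-reflexive)
open import Data.Fin using (Fin)
open import Data.List using (List; []; _∷_; _++_; length)
open import Data.List.Relation.Unary.All using (All; []; _∷_)
open import Data.List.Relation.Unary.AllPairs using (_∷_)
open import Data.List.Relation.Unary.Any using (here; there)
open import Data.List.Relation.Unary.Linked as Linked using (Linked; []; [-]; _∷_)
open import Data.Maybe using (just)
open import Data.Maybe.Properties using (just-injective)
open import Data.Product using (Σ; ∃; ∃₂; _×_; _,_)
open import Data.Sum using (inj₁; inj₂)
open import Data.Empty using (⊥; ⊥-elim)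
open import Relation.Nullary using (¬_)
open import Relation.Binary.PropositionalEquality using (_≡_; _≢_; refl; sym; trans; cong; subst)
open import Relation.Binary.Construct.Closure.ReflexiveTransitive using (ε; _◅_)
open import Function.Bundles using (_⇔_; mk⇔; Equivalence)

open Equivalence using (to; from)

data Even : ℕ → Set
data Odd : ℕ → Set

data Even where
  zero : Even 0
  suc  : ∀ {n} → Odd n → Even (suc n)

data Odd where
  suc : ∀ {n} → Even n → Odd (suc n)

even⇒¬odd : ∀ {n} → Even n → ¬ Odd n
even⇒¬odd (suc o) (suc e) = even⇒¬odd e o

odd⇒1≤ : ∀ {n} → Odd n → 1 ≤ n
odd⇒1≤ (suc _) = s≤s z≤n

2+[2k+1]≡2[1+k]+1 : ∀ k → 2 + (2 * k + 1) ≡ 2 * suc k + 1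
2+[2k+1]≡2[1+k]+1 k = cong (λ x → suc (x + 1)) (sym (+-suc k (k + 0)))

≡2k+1⇒odd : ∀ {n} → (∃ λ k → n ≡ 2 * k + 1) → Odd n
≡2k+1⇒odd (zero  , refl) = suc zero
≡2k+1⇒odd (suc k , refl) =
  subst Odd (2+[2k+1]≡2[1+k]+1 k) (suc (suc (≡2k+1⇒odd (k , refl))))

odd⇒≡2k+1 : ∀ {n} → Odd n → ∃ λ k → n ≡ 2 * k + 1
odd⇒≡2k+1 (suc zero) = 0 , refl
odd⇒≡2k+1 (suc (suc o)) with odd⇒≡2k+1 o
... | k , refl = suc k , 2+[2k+1]≡2[1+k]+1 k

module _ {n : ℕ} (M : CoxeterMatrix n) where

  infix 4 _∼_

  _∼_ : Fin n → Fin n → Set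
  a ∼ b = m M a b ≡ 3

  ∼-irrefl : ∀ {a b} → a ∼ b → a ≢ b
  ∼-irrefl {a} a∼a refl with trans (sym a∼a) (diag M a)
  ... | ()

  ∼-sym : ∀ {a b} → a ∼ b → b ∼ a
  ∼-sym {a} {b} a∼b = trans (CoxeterMatrix.sym M b a) a∼b

  ∼⇒edge : ∀ {a b} → a ∼ b → Edge M a b
  ∼⇒edge a∼b = ∼-irrefl a∼b , ≤-reflexive (sym a∼b)

  at≡just⇒< : ∀ w {k x} → at M w k ≡ just x → k < length w
  at≡just⇒< (_ ∷ _) {zero}  _  = s≤s z≤n
  at≡just⇒< (_ ∷ w) {suc k} eq = s≤s (at≡just⇒< w eq)

  -- The braid shadow ⟦p+1, p+3⟧ in 0-based positions, so that p + 1 and p + 2 are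
  -- successors rather than sums.
  Shadow₀ : Word M → ℕ → Set
  Shadow₀ w p = Σ (Fin n) λ a → Σ (Fin n) λ b →
    at M w p ≡ just a × at M w (suc p) ≡ just b × at M w (suc (suc p)) ≡ just a × a ∼ b

  shadow⇔shadow₀ : ∀ w p → Shadow M w (suc p) ⇔ Shadow₀ w p
  shadow⇔shadow₀ w p = mk⇔
    (λ (_ , a , b , eq₀ , eq₁ , eq₂ , a∼b) →
      a , b , eq₀ , eq₁ , subst (λ k → at M w (suc k) ≡ just a) (+-comm p 1) eq₂ , a∼b)
    (λ (a , b , eq₀ , eq₁ , eq₂ , a∼b) →
      s≤s z≤n , a , b , eq₀ , eq₁ , subst (λ k → at M w (suc k) ≡ just a) (+-comm 1 p) eq₂ , a∼b)

  -- In 0-based positions an even p is the odd paper position p + 1.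
  OddShadows : Word M → Set
  OddShadows w = ∀ p → Even p → 2 + p < length w → Shadow₀ w p

  NoEvenShadows : Word M → Set
  NoEvenShadows w = ∀ p → Even p → ¬ Shadow₀ w (suc p)

  oddShadows-tail : ∀ {x y w} → OddShadows (x ∷ y ∷ w) → OddShadows w
  oddShadows-tail shadows p e 2+p<|w| = shadows (2 + p) (suc (suc e)) (s≤s (s≤s 2+p<|w|))

  noEvenShadows-tail : ∀ {x y w} → NoEvenShadows (x ∷ y ∷ w) → NoEvenShadows w
  noEvenShadows-tail noShadows p e = noShadows (2 + p) (suc (suc e))

  link⇒odd-length : ∀ {w} → Link M w → Odd (length w)
  link⇒odd-length (_ , _ , inj₁ |w|≡1)     = ≡2k+1⇒odd (0 , |w|≡1)
  link⇒odd-length (_ , _ , inj₂ (odd , _)) = ≡2k+1⇒odd odd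

  link⇒noEvenShadows : ∀ w → Link M w → NoEvenShadows w
  link⇒noEvenShadows w (_ , _ , inj₁ |w|≡1) p _ (_ , _ , _ , eq₁ , _)
    with subst (2 + p <_) |w|≡1 (at≡just⇒< w eq₁)
  ... | s≤s ()
  link⇒noEvenShadows w (_ , _ , inj₂ (_ , classShadows)) p e shadow
    with to (classShadows (2 + p)) (w , ε , from (shadow⇔shadow₀ w (suc p)) shadow)
  ... | odd , _ with ≡2k+1⇒odd odd
  ...   | suc (suc o) = even⇒¬odd e o

  fibonacciLink⇒oddShadows : ∀ w → FibonacciLink M w → OddShadows w
  fibonacciLink⇒oddShadows w ((_ , _ , inj₁ |w|≡1) , _) p _ 2+p<|w|
    with subst (2 + p <_) |w|≡1 2+p<|w|
  ... | s≤s ()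
  fibonacciLink⇒oddShadows w ((_ , _ , inj₂ (_ , classShadows)) , fibonacci) p e 2+p<|w| =
    to (shadow⇔shadow₀ w p) (to (fibonacci (suc p)) (from (classShadows (suc p)) (odd , bound)))
    where
    odd : ∃ λ k → suc p ≡ 2 * k + 1
    odd = odd⇒≡2k+1 (suc e)

    bound : suc p + 2 ≤ length w
    bound = subst (λ k → suc k ≤ length w) (+-comm 2 p) 2+p<|w|

  zigzag : Fin n → List (Fin n) → Word M
  zigzag a []       = a ∷ []
  zigzag a (b ∷ bs) = a ∷ b ∷ zigzag a bs

  at-zigzag-0 : ∀ a bs → at M (zigzag a bs) 0 ≡ just a
  at-zigzag-0 a []      = refl
  at-zigzag-0 a (_ ∷ _) = refl

  noEvenShadows⇒distinct : ∀ {a y bs} → NoEvenShadows (a ∷ y ∷ zigzag a bs) →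
    a ∼ y → Linked _≢_ bs → Linked _≢_ (y ∷ bs)
  noEvenShadows⇒distinct {bs = []}    _         _   _        = [-]
  noEvenShadows⇒distinct {a} {y} {bs = _ ∷ _} noShadows a∼y distinct =
    (λ { refl → noShadows 0 zero (y , a , refl , refl , refl , ∼-sym a∼y) }) ∷ distinct

  oddShadows⇒zigzag : ∀ w → Odd (length w) → OddShadows w → NoEvenShadows w →
    ∃₂ λ a bs → w ≡ zigzag a bs × All (a ∼_) bs × Linked _≢_ bs
  oddShadows⇒zigzag (x ∷ []) _ _ _ = x , [] , refl , [] , []
  oddShadows⇒zigzag (x ∷ y ∷ w) (suc (suc o)) shadows noShadows
    with oddShadows⇒zigzag w o (oddShadows-tail {x} {y} shadows) (noEvenShadows-tail {x} {y} noShadows)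
  ... | a , bs , refl , adjacent , distinct
    with shadows 0 zero (s≤s (s≤s (odd⇒1≤ o)))
  ... | _ , _ , refl , refl , eq₂ , x∼y
    with just-injective (trans (sym (at-zigzag-0 a bs)) eq₂)
  ... | refl = a , y ∷ bs , refl , x∼y ∷ adjacent , noEvenShadows⇒distinct noShadows x∼y distinct

  fibonacciLink⇒zigzag : ∀ φ → FibonacciLink M φ →
    ∃₂ λ a bs → φ ≡ zigzag a bs × All (a ∼_) bs × Linked _≢_ bs
  fibonacciLink⇒zigzag φ fib@(link , _) =
    oddShadows⇒zigzag φ (link⇒odd-length link) (fibonacciLink⇒oddShadows φ fib)
      (link⇒noEvenShadows φ link)

  data ZigzagClass (a : Fin n) : List (Fin n) → Word M → Set where
    end      : ZigzagClass a [] (a ∷ [])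
    keep     : ∀ {b bs w} → ZigzagClass a bs w → ZigzagClass a (b ∷ bs) (a ∷ b ∷ w)
    flip-end : ∀ {b} → ZigzagClass a (b ∷ []) (b ∷ a ∷ b ∷ [])
    flip     : ∀ {b b′ bs w} → ZigzagClass a bs w →
               ZigzagClass a (b ∷ b′ ∷ bs) (b ∷ a ∷ b ∷ b′ ∷ w)

  zigzag∈zigzagClass : ∀ a bs → ZigzagClass a bs (zigzag a bs)
  zigzag∈zigzagClass a []       = end
  zigzag∈zigzagClass a (_ ∷ bs) = keep (zigzag∈zigzagClass a bs)

  zigzagClass-nonempty : ∀ {a bs w} → ZigzagClass a bs w → 1 ≤ length w
  zigzagClass-nonempty end      = s≤s z≤n
  zigzagClass-nonempty (keep _) = s≤s z≤n
  zigzagClass-nonempty flip-end = s≤s z≤n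
  zigzagClass-nonempty (flip _) = s≤s z≤n

  zigzagClass-flip-first : ∀ {a b bs v} → All (a ∼_) bs →
    ZigzagClass a bs (a ∷ v) → ZigzagClass a (b ∷ bs) (b ∷ a ∷ b ∷ v)
  zigzagClass-flip-first _          end      = flip-end
  zigzagClass-flip-first _          (keep w) = flip w
  zigzagClass-flip-first (a∼a ∷ _) flip-end = ⊥-elim (∼-irrefl a∼a refl)
  zigzagClass-flip-first (a∼a ∷ _) (flip _) = ⊥-elim (∼-irrefl a∼a refl)

  zigzagClass-second≢ : ∀ {a c bs t v} → a ∼ c → Linked _≢_ (c ∷ bs) →
    ¬ ZigzagClass a bs (t ∷ c ∷ v)
  zigzagClass-second≢ _   (c≢c ∷ _) (keep _) = c≢c refl
  zigzagClass-second≢ a∼a _         flip-end = ∼-irrefl a∼a refl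
  zigzagClass-second≢ a∼a _         (flip _) = ∼-irrefl a∼a refl

  zigzagClass-startingWith⇒zigzag : ∀ {a bs w} → All (a ∼_) bs → ZigzagClass a bs w →
    OddShadows w → at M w 0 ≡ just a → w ≡ zigzag a bs
  zigzagClass-startingWith⇒zigzag _ end _ _ = refl
  zigzagClass-startingWith⇒zigzag {a} (_ ∷ adjacent) (keep {b} w) shadows _
    with shadows 0 zero (s≤s (s≤s (zigzagClass-nonempty w)))
  ... | _ , _ , eq₀ , _ , eq₂ , _ =
    cong (λ v → a ∷ b ∷ v)
      (zigzagClass-startingWith⇒zigzag adjacent w (oddShadows-tail shadows) (trans eq₂ (sym eq₀)))
  zigzagClass-startingWith⇒zigzag (a∼b ∷ _) flip-end _ eq =
    ⊥-elim (∼-irrefl a∼b (sym (just-injective eq)))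
  zigzagClass-startingWith⇒zigzag (a∼b ∷ _) (flip _) _ eq =
    ⊥-elim (∼-irrefl a∼b (sym (just-injective eq)))

  module _ (triangleFree : TriangleFree M) where

    no-triangle : ∀ {a b c} → a ∼ b → b ∼ c → a ∼ c → ⊥
    no-triangle {a} {b} {c} a∼b b∼c a∼c =
      triangleFree a b c (∼⇒edge a∼b , ∼⇒edge b∼c , ∼⇒edge a∼c)

    braidMove-zigzagClass : ∀ {a bs w} u v s t → All (a ∼_) bs → Linked _≢_ bs → s ∼ t →
      ZigzagClass a bs w → w ≡ u ++ s ∷ t ∷ s ∷ v → ZigzagClass a bs (u ++ t ∷ s ∷ t ∷ v)
    braidMove-zigzagClass []          _ _ _ _ _ _ end ()
    braidMove-zigzagClass (_ ∷ [])    _ _ _ _ _ _ end ()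
    braidMove-zigzagClass (_ ∷ _ ∷ _) _ _ _ _ _ _ end ()
    braidMove-zigzagClass [] _ _ _ (_ ∷ adjacent) _ _ (keep w) refl =
      zigzagClass-flip-first adjacent w
    braidMove-zigzagClass (_ ∷ []) _ _ _ (a∼b ∷ _) distinct _ (keep w) refl =
      ⊥-elim (zigzagClass-second≢ a∼b distinct w)
    braidMove-zigzagClass (_ ∷ _ ∷ u) v s t (_ ∷ adjacent) distinct s∼t (keep w) refl =
      keep (braidMove-zigzagClass u v s t adjacent (Linked.tail distinct) s∼t w refl)
    braidMove-zigzagClass []                  _ _ _ _ _ _ flip-end refl = keep end
    braidMove-zigzagClass (_ ∷ [])            _ _ _ _ _ _ flip-end ()
    braidMove-zigzagClass (_ ∷ _ ∷ [])        _ _ _ _ _ _ flip-end ()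
    braidMove-zigzagClass (_ ∷ _ ∷ _ ∷ [])    _ _ _ _ _ _ flip-end ()
    braidMove-zigzagClass (_ ∷ _ ∷ _ ∷ _ ∷ _) _ _ _ _ _ _ flip-end ()
    braidMove-zigzagClass [] _ _ _ _ _ _ (flip w) refl = keep (keep w)
    braidMove-zigzagClass (_ ∷ []) _ _ _ (_ ∷ a∼a ∷ _) _ _ (flip _) refl =
      ⊥-elim (∼-irrefl a∼a refl)
    braidMove-zigzagClass (_ ∷ _ ∷ []) _ _ _ (a∼b ∷ a∼b′ ∷ _) _ b∼b′ (flip _) refl =
      ⊥-elim (no-triangle a∼b b∼b′ a∼b′)
    braidMove-zigzagClass (_ ∷ _ ∷ _ ∷ []) _ _ _ (_ ∷ a∼b′ ∷ _) distinct _ (flip w) refl =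
      ⊥-elim (zigzagClass-second≢ a∼b′ (Linked.tail distinct) w)
    braidMove-zigzagClass (_ ∷ _ ∷ _ ∷ _ ∷ u) v s t (_ ∷ _ ∷ adjacent) distinct s∼t (flip w) refl =
      flip (braidMove-zigzagClass u v s t adjacent (Linked.tail (Linked.tail distinct)) s∼t w refl)

    braidClass-zigzagClass : ∀ {a bs w w′} → All (a ∼_) bs → Linked _≢_ bs →
      ZigzagClass a bs w → InBraidClass M w w′ → ZigzagClass a bs w′
    braidClass-zigzagClass _ _ w ε = w
    braidClass-zigzagClass adjacent distinct w (braid u v s t s∼t ◅ moves) =
      braidClass-zigzagClass adjacent distinct
        (braidMove-zigzagClass u v s t adjacent distinct s∼t w refl) moves

    zigzagClass-oddShadows⇒zigzag : ∀ {a bs w} → All (a ∼_) bs → 2 ≤ length bs →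
      ZigzagClass a bs w → OddShadows w → w ≡ zigzag a bs
    zigzagClass-oddShadows⇒zigzag _ () end _
    zigzagClass-oddShadows⇒zigzag _ (s≤s ()) flip-end _
    zigzagClass-oddShadows⇒zigzag adjacent _ w@(keep _) shadows =
      zigzagClass-startingWith⇒zigzag adjacent w shadows refl
    zigzagClass-oddShadows⇒zigzag (a∼b ∷ a∼b′ ∷ _) _ (flip w) shadows
      with shadows 2 (suc (suc zero)) (s≤s (s≤s (s≤s (s≤s (zigzagClass-nonempty w)))))
    ... | _ , _ , refl , refl , _ , b∼b′ = ⊥-elim (no-triangle a∼b b∼b′ a∼b′)

  ¬shadow-[x] : ∀ {x} i → ¬ Shadow M (x ∷ []) i
  ¬shadow-[x] (suc _) (_ , _ , _ , _ , () , _)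

  shadow-[x,y,z]⇒≡1 : ∀ {x y z} i → Shadow M (x ∷ y ∷ z ∷ []) i → i ≡ 1
  shadow-[x,y,z]⇒≡1 (suc zero)                 _                      = refl
  shadow-[x,y,z]⇒≡1 (suc (suc zero))    (_ , _ , _ , _ , _ , () , _)
  shadow-[x,y,z]⇒≡1 (suc (suc (suc _))) (_ , _ , _ , _ , () , _)

  zigzag-shadows⇒2≤length : ∀ {a bs i j} → i ≢ j →
    Shadow M (zigzag a bs) i → Shadow M (zigzag a bs) j → 2 ≤ length bs
  zigzag-shadows⇒2≤length {bs = []}     {i} _ shadowᵢ _ = ⊥-elim (¬shadow-[x] i shadowᵢ)
  zigzag-shadows⇒2≤length {bs = _ ∷ []} {i} {j} i≢j shadowᵢ shadowⱼ =
    ⊥-elim (i≢j (trans (shadow-[x,y,z]⇒≡1 i shadowᵢ) (sym (shadow-[x,y,z]⇒≡1 j shadowⱼ))))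
  zigzag-shadows⇒2≤length {bs = _ ∷ _ ∷ _} _ _ _ = s≤s (s≤s z≤n)

  rank≥2⇒two-classShadows : ∀ {α r} → Rank M α r → 2 ≤ r →
    ∃₂ λ i j → i ≢ j × ClassShadow M α i × ClassShadow M α j
  rank≥2⇒two-classShadows ([] , _ , _ , refl) ()
  rank≥2⇒two-classShadows (_ ∷ [] , _ , _ , refl) (s≤s ())
  rank≥2⇒two-classShadows (i ∷ j ∷ _ , (i≢j ∷ _) ∷ _ , mem , refl) _ =
    i , j , i≢j , to (mem i) (here refl) , to (mem j) (there (here refl))

corollary6p12 : (n : ℕ) (M : CoxeterMatrix n) → SimplyLaced M → TriangleFree M →
    (φ : Word M) (r : ℕ) → FibonacciLink M φ → Rank M φ r → 2 ≤ r →
    (ψ : Word M) → InBraidClass M φ ψ → FibonacciLink M ψ → ψ ≡ φ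
corollary6p12 n M _ triangleFree φ r fibφ@(_ , shadowsφ) rankφ 2≤r ψ φ⇝ψ fibψ
  with fibonacciLink⇒zigzag M φ fibφ | rank≥2⇒two-classShadows M rankφ 2≤r
... | a , bs , refl , adjacent , distinct | i , j , i≢j , classShadowᵢ , classShadowⱼ =
  zigzagClass-oddShadows⇒zigzag M triangleFree adjacent 2≤|bs| ψ∈class
    (fibonacciLink⇒oddShadows M ψ fibψ)
  where
  2≤|bs| : 2 ≤ length bs
  2≤|bs| = zigzag-shadows⇒2≤length M {a} {bs} i≢j
    (to (shadowsφ i) classShadowᵢ) (to (shadowsφ j) classShadowⱼ)

  ψ∈class : ZigzagClass M a bs ψ
  ψ∈class = braidClass-zigzagClass M triangleFree adjacent distinct
    (zigzag∈zigzagClass M a bs) φ⇝ψ
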